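{- Let $\vec H$ be a fixed oriented graph whose underlying graph $H$ is bipartite with bipartition $V(H)=A(H)\sqcup B(H)$ such that $\vec H$ is well-oriented with respect to this bipartition (every arc goes from $A(H)$ to $B(H)$). Let \[\Delta'(H)=\min\Big\{\max_{v\in A(H)}\deg_H(v),\ \max_{v\in B(H)}\deg_H(v)\Big\}.\] Then $\mathrm{ex}(n,\vec H)=O(n^{2-1/\Delta'(H)})$.
   Context: An oriented graph is a digraph in which each pair of vertices is joined by at most one arc; its underlying graph is the undirected simple graph obtained by forgetting orientations. $\mathrm{ex}(n,\vec H)$ is the maximum number of arcs in an $n$-vertex oriented graph that contains no copy of $\vec H$ as a subgraph (copies must respect orientations). Asymptotics are in $n$ with $\vec H$ fixed. -}

module Defs where

open import Data.Nat using (ℕ; _+_; _⊔_; _⊓_)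
open import Data.Nat.ListAction using (sum)
open import Data.Bool using (Bool; true; false; if_then_else_; _∨_)
open import Data.Fin using (Fin)
open import Data.List using (List; map; allFin; foldr)
open import Data.Product using (_×_; Σ)
open import Function.Definitions using (Injective)
open import Relation.Binary.PropositionalEquality using (_≡_)

record OrientedGraph (n : ℕ) : Set where
  field
    arc     : Fin n → Fin n → Bool
    loopless : ∀ u → arc u u ≡ false
    oriented : ∀ u v → arc u v ≡ true → arc v u ≡ false
open OrientedGraph public

count : ∀ {n} → (Fin n → Bool) → ℕ
count {n} p = sum (map (λ i → if p i then 1 else 0) (allFin n))

arcs : ∀ {n} → OrientedGraph n → ℕ
arcs {n} G = sum (map (λ u → count (λ v → arc G u v)) (allFin n))

deg : ∀ {n} → OrientedGraph n → Fin n → ℕ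
deg G v = count (λ w → arc G v w ∨ arc G w v)

maxFin : ∀ {n} → (Fin n → ℕ) → ℕ
maxFin {n} f = foldr _⊔_ 0 (map f (allFin n))

Contains : ∀ {n h} → OrientedGraph n → OrientedGraph h → Set
Contains {n} {h} G H =
  Σ (Fin h → Fin n) λ φ → Injective _≡_ _≡_ φ × (∀ u v → arc H u v ≡ true → arc G (φ u) (φ v) ≡ true)

-- side : Fin h → Bool encodes the bipartition; side v ≡ true means v ∈ A(H).
-- Well-oriented: every arc goes from A(H) to B(H).
WellOriented : ∀ {h} → OrientedGraph h → (Fin h → Bool) → Set
WellOriented H side = ∀ u v → arc H u v ≡ true → (side u ≡ true) × (side v ≡ false)

Δ' : ∀ {h} → OrientedGraph h → (Fin h → Bool) → ℕ
Δ' H side = maxFin (λ v → if side v then deg H v else 0)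
        ⊓ maxFin (λ v → if side v then 0 else deg H v)

module Submission where

-- Dependent random choice, in counting form. Let D bound the in-degrees of the B-vertices (reversing all
-- arcs if necessary, D = Δ'(H)) and let e be the number of arcs of G. Summed over all n^D tuples T, the
-- common in-neighbourhoods U(T) have total size Σ_u outdeg(u)^D ≥ e^D / n^(D-1) (power mean), while the
-- pairs (T, S) with S ⊆ U(T) a tuple having fewer than 2h common out-neighbours number at most n^D (2h)^D.
-- Hence if e^D > (h + (2h)^D) n^(2D-1), some U(T) keeps h vertices after deleting one vertex of each such
-- S, and every D-tuple in what is left has 2h common out-neighbours. H then embeds greedily: the
-- A-vertices onto distinct vertices of that set, each B-vertex onto a fresh common out-neighbour of the
-- images of its at most D in-neighbours.

open import Defs
open import Algebra.Bundles using (CommutativeMonoid)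
open import Data.Bool using (Bool; true; false; T; T?; if_then_else_; _∧_; _∨_; not)
open import Data.Bool.Properties using (not-injective; ∨-zeroʳ; ∧-commutativeMonoid)
open import Data.Fin using (Fin; zero; suc)
open import Data.Fin.Properties using (_≟_)
open import Data.List using (List; []; _∷_; [_]; _++_; map; foldr; length; allFin; concatMap; filterᵇ)
open import Data.List.Properties using (map-++; length-map; map-tabulate; length-tabulate)
open import Data.List.Membership.Propositional using (_∈_; _∉_)
open import Data.List.Membership.Propositional.Properties using (∈-allFin; ∈-map⁺; ∈-map⁻; ∈-filter⁺)
open import Data.List.Relation.Unary.Any using (here; there; any?)
open import Data.Nat using (ℕ; zero; suc; _+_; _*_; _^_; _∸_; _⊔_; _≤_; _<_; z≤n; s≤s; _<ᵇ_; _<?_)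
open import Data.Nat.ListAction using (sum)
open import Data.Nat.ListAction.Properties using (sum-++)
open import Data.Nat.Properties hiding (_≟_)
open import Data.Nat.Solver using (module +-*-Solver)
open import Data.Product using (Σ; ∃-syntax; _×_; _,_; proj₁; proj₂)
open import Data.Sum using (inj₁; inj₂)
open import Data.Unit using (tt)
open import Data.Vec using (Vec; []; _∷_)
open import Function.Base using (_∘_)
open import Function.Definitions using (Injective)
open import Relation.Binary.PropositionalEquality hiding ([_])
open import Relation.Nullary using (¬_; does; yes; no; contradiction)

open import Algebra.Properties.CommutativeSemigroup +-commutativeSemigroup
  using () renaming (interchange to +-interchange)
open import Algebra.Properties.CommutativeSemigroup *-commutativeSemigroup
  using () renaming (x∙yz≈y∙xz to *-leftComm)
open import Algebra.Properties.CommutativeSemigroup (CommutativeMonoid.commutativeSemigroup ∧-commutativeMonoid)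
  using () renaming (interchange to ∧-interchange)

private variable
  A B : Set
  n h d e : ℕ

∑ : List A → (A → ℕ) → ℕ
∑ L f = sum (map f L)

syntax ∑ L (λ x → e) = ∑[ x ∈ L ] e

∑-cong : ∀ (L : List A) {f g : A → ℕ} → (∀ x → f x ≡ g x) → ∑ L f ≡ ∑ L g
∑-cong []      f≗g = refl
∑-cong (x ∷ L) f≗g = cong₂ _+_ (f≗g x) (∑-cong L f≗g)

∑-mono-≤ : ∀ (L : List A) {f g : A → ℕ} → (∀ x → f x ≤ g x) → ∑ L f ≤ ∑ L g
∑-mono-≤ []      f≤g = z≤n
∑-mono-≤ (x ∷ L) f≤g = +-mono-≤ (f≤g x) (∑-mono-≤ L f≤g)

∑-distrib-+ : ∀ (L : List A) (f g : A → ℕ) → ∑[ x ∈ L ] (f x + g x) ≡ ∑ L f + ∑ L g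
∑-distrib-+ []      f g = refl
∑-distrib-+ (x ∷ L) f g rewrite ∑-distrib-+ L f g = +-interchange (f x) (g x) (∑ L f) (∑ L g)

*-distribˡ-∑ : ∀ (L : List A) (c : ℕ) (f : A → ℕ) → ∑[ x ∈ L ] (c * f x) ≡ c * ∑ L f
*-distribˡ-∑ []      c f = sym (*-zeroʳ c)
*-distribˡ-∑ (x ∷ L) c f rewrite *-distribˡ-∑ L c f = sym (*-distribˡ-+ c (f x) (∑ L f))

*-distribʳ-∑ : ∀ (L : List A) (c : ℕ) (f : A → ℕ) → ∑[ x ∈ L ] (f x * c) ≡ ∑ L f * c
*-distribʳ-∑ []      c f = refl
*-distribʳ-∑ (x ∷ L) c f rewrite *-distribʳ-∑ L c f = sym (*-distribʳ-+ c (f x) (∑ L f))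

∑-const : ∀ (L : List A) (c : ℕ) → ∑[ _ ∈ L ] c ≡ length L * c
∑-const []      c = refl
∑-const (x ∷ L) c = cong (c +_) (∑-const L c)

∑-zero : ∀ (L : List A) → ∑[ _ ∈ L ] 0 ≡ 0
∑-zero L = trans (∑-const L 0) (*-zeroʳ (length L))

∑-comm : ∀ (L : List A) (M : List B) (f : A → B → ℕ) →
         ∑[ x ∈ L ] ∑[ y ∈ M ] f x y ≡ ∑[ y ∈ M ] ∑[ x ∈ L ] f x y
∑-comm []      M f = sym (∑-zero M)
∑-comm (x ∷ L) M f rewrite ∑-comm L M f = sym (∑-distrib-+ M (f x) (λ y → ∑[ x′ ∈ L ] f x′ y))

∑-++ : ∀ (L M : List A) (f : A → ℕ) → ∑ (L ++ M) f ≡ ∑ L f + ∑ M f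
∑-++ L M f = trans (cong sum (map-++ f L M)) (sum-++ (map f L) (map f M))

∑-map : ∀ (g : A → B) (L : List A) (f : B → ℕ) → ∑ (map g L) f ≡ ∑[ x ∈ L ] f (g x)
∑-map g []      f = refl
∑-map g (x ∷ L) f = cong (f (g x) +_) (∑-map g L f)

∑-concatMap : ∀ (g : A → List B) (L : List A) (f : B → ℕ) → ∑ (concatMap g L) f ≡ ∑[ x ∈ L ] ∑ (g x) f
∑-concatMap g []      f = refl
∑-concatMap g (x ∷ L) f = trans (∑-++ (g x) (concatMap g L) f) (cong (∑ (g x) f +_) (∑-concatMap g L f))

∈⇒≤∑ : ∀ {L : List A} (f : A → ℕ) {x} → x ∈ L → f x ≤ ∑ L f
∈⇒≤∑ {L = y ∷ L} f (here refl) = m≤m+n (f y) (∑ L f)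
∈⇒≤∑ {L = y ∷ L} f (there x∈L) = ≤-trans (∈⇒≤∑ f x∈L) (m≤n+m (∑ L f) (f y))

∑-<⇒∃-< : ∀ (L : List A) (f g : A → ℕ) → ∑ L f < ∑ L g → ∃[ x ] f x < g x
∑-<⇒∃-< (x ∷ L) f g ∑f<∑g with f x <? g x
... | yes fx<gx = x , fx<gx
... | no  fx≮gx = ∑-<⇒∃-< L f g (+-cancelˡ-< (g x) (∑ L f) (∑ L g)
                    (≤-<-trans (+-monoˡ-≤ (∑ L f) (≮⇒≥ fx≮gx)) ∑f<∑g))

-- Chebyshev's sum inequality and the power mean inequality

rearrangement-≤ : ∀ {a a′ b b′} → a ≤ a′ → b ≤ b′ → a * b′ + a′ * b ≤ a * b + a′ * b′
rearrangement-≤ {a} {_} {b} a≤a′ b≤b′ with m≤n⇒∃[o]m+o≡n a≤a′ | m≤n⇒∃[o]m+o≡n b≤b′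
... | k , refl | l , refl = subst (a * (b + l) + (a + k) * b ≤_) (sym difference) (m≤m+n _ (k * l))
  where
  open +-*-Solver
  difference : a * b + (a + k) * (b + l) ≡ (a * (b + l) + (a + k) * b) + k * l
  difference = solve 4 (λ a b k l → a :* b :+ (a :+ k) :* (b :+ l) := (a :* (b :+ l) :+ (a :+ k) :* b) :+ k :* l)
                 refl a b k l

rearrangement : ∀ a a′ b b′ → (a ≤ a′ → b ≤ b′) → (a′ ≤ a → b′ ≤ b) →
                a * b′ + a′ * b ≤ a * b + a′ * b′
rearrangement a a′ b b′ mono mono′ with ≤-total a a′
... | inj₁ a≤a′ = rearrangement-≤ a≤a′ (mono a≤a′)
... | inj₂ a′≤a = subst₂ _≤_ (+-comm (a′ * b) (a * b′)) (+-comm (a′ * b′) (a * b))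
                    (rearrangement-≤ a′≤a (mono′ a′≤a))

chebyshev : ∀ (L : List A) (f g : A → ℕ) → (∀ x y → f x ≤ f y → g x ≤ g y) →
            ∑ L f * ∑ L g ≤ length L * ∑[ x ∈ L ] (f x * g x)
chebyshev L f g mono = *-cancelˡ-≤ 2 (begin
  2 * (∑ L f * ∑ L g)                            ≡⟨ crossSum ⟨
  ∑[ x ∈ L ] ∑[ y ∈ L ] (f x * g y + f y * g x)  ≤⟨ ∑-mono-≤ L (λ x → ∑-mono-≤ L (λ y →
                                                      rearrangement (f x) (f y) (g x) (g y) (mono x y) (mono y x))) ⟩
  ∑[ x ∈ L ] ∑[ y ∈ L ] (fg x + fg y)            ≡⟨ diagonalSum ⟩
  2 * (length L * ∑ L fg)                        ∎)
  where
  open ≤-Reasoning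
  fg = λ x → f x * g x
  double : ∀ m → m + m ≡ 2 * m
  double m = cong (m +_) (sym (+-identityʳ m))
  crossSum : ∑[ x ∈ L ] ∑[ y ∈ L ] (f x * g y + f y * g x) ≡ 2 * (∑ L f * ∑ L g)
  crossSum = begin-equality
    ∑[ x ∈ L ] ∑[ y ∈ L ] (f x * g y + f y * g x)
      ≡⟨ ∑-cong L (λ x → trans (∑-distrib-+ L _ _)
                               (cong₂ _+_ (*-distribˡ-∑ L (f x) g) (*-distribʳ-∑ L (g x) f))) ⟩
    ∑[ x ∈ L ] (f x * ∑ L g + ∑ L f * g x)
      ≡⟨ ∑-distrib-+ L _ _ ⟩
    ∑[ x ∈ L ] (f x * ∑ L g) + ∑[ x ∈ L ] (∑ L f * g x)
      ≡⟨ cong₂ _+_ (*-distribʳ-∑ L (∑ L g) f) (*-distribˡ-∑ L (∑ L f) g) ⟩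
    ∑ L f * ∑ L g + ∑ L f * ∑ L g
      ≡⟨ double (∑ L f * ∑ L g) ⟩
    2 * (∑ L f * ∑ L g) ∎
  diagonalSum : ∑[ x ∈ L ] ∑[ y ∈ L ] (fg x + fg y) ≡ 2 * (length L * ∑ L fg)
  diagonalSum = begin-equality
    ∑[ x ∈ L ] ∑[ y ∈ L ] (fg x + fg y)
      ≡⟨ ∑-cong L (λ x → trans (∑-distrib-+ L _ _) (cong (_+ ∑ L fg) (∑-const L (fg x)))) ⟩
    ∑[ x ∈ L ] (length L * fg x + ∑ L fg)
      ≡⟨ ∑-distrib-+ L _ _ ⟩
    ∑[ x ∈ L ] (length L * fg x) + ∑[ _ ∈ L ] ∑ L fg
      ≡⟨ cong₂ _+_ (*-distribˡ-∑ L (length L) fg) (∑-const L (∑ L fg)) ⟩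
    length L * ∑ L fg + length L * ∑ L fg
      ≡⟨ double (length L * ∑ L fg) ⟩
    2 * (length L * ∑ L fg) ∎

powerMean : ∀ (L : List A) (f : A → ℕ) d → ∑ L f ^ suc d ≤ length L ^ d * ∑[ x ∈ L ] (f x ^ suc d)
powerMean L f zero = subst₂ _≤_ (sym (*-identityʳ (∑ L f))) (sym (+-identityʳ _))
                       (≤-reflexive (∑-cong L (λ x → sym (*-identityʳ (f x)))))
powerMean L f (suc d) = begin
  ∑ L f * ∑ L f ^ suc d                         ≤⟨ *-monoʳ-≤ (∑ L f) (powerMean L f d) ⟩
  ∑ L f * (ℓ ^ d * ∑[ x ∈ L ] (f x ^ suc d))    ≡⟨ *-leftComm (∑ L f) (ℓ ^ d) _ ⟩
  ℓ ^ d * (∑ L f * ∑[ x ∈ L ] (f x ^ suc d))    ≤⟨ *-monoʳ-≤ (ℓ ^ d) (chebyshev L f (λ x → f x ^ suc d)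
                                                     (λ x y fx≤fy → ^-monoˡ-≤ (suc d) fx≤fy)) ⟩
  ℓ ^ d * (ℓ * ∑[ x ∈ L ] (f x ^ suc (suc d)))  ≡⟨ trans (*-leftComm (ℓ ^ d) ℓ _) (sym (*-assoc ℓ (ℓ ^ d) _)) ⟩
  ℓ ^ suc d * ∑[ x ∈ L ] (f x ^ suc (suc d))    ∎
  where
  open ≤-Reasoning
  ℓ = length L

∧-true⁻ : ∀ {a b} → a ∧ b ≡ true → a ≡ true × b ≡ true
∧-true⁻ {true} b≡true = refl , b≡true

<ᵇ-true⁻ : ∀ {m k} → (m <ᵇ k) ≡ true → m < k
<ᵇ-true⁻ {m} {k} m<ᵇk = <ᵇ⇒< m k (subst T (sym m<ᵇk) tt)

<ᵇ-false⁻ : ∀ {m k} → (m <ᵇ k) ≡ false → k ≤ m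
<ᵇ-false⁻ m≮ᵇk = ≮⇒≥ (λ m<k → subst T m≮ᵇk (<⇒<ᵇ m<k))

indicator : Bool → ℕ
indicator b = if b then 1 else 0

indicator-∧ : ∀ a b → indicator (a ∧ b) ≡ indicator a * indicator b
indicator-∧ true  b = sym (+-identityʳ (indicator b))
indicator-∧ false b = refl

indicator-∨ : ∀ a b → indicator (a ∨ b) ≤ indicator a + indicator b
indicator-∨ true  b = s≤s z≤n
indicator-∨ false b = ≤-refl

indicator-split : ∀ a b → indicator a ≤ indicator (a ∧ not b) + indicator b
indicator-split true  true  = s≤s z≤n
indicator-split true  false = s≤s z≤n
indicator-split false b     = z≤n

indicator-mono : ∀ {a b} → (a ≡ true → b ≡ true) → indicator a ≤ indicator b
indicator-mono {false} a⇒b = z≤n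
indicator-mono {true}  a⇒b rewrite a⇒b refl = ≤-refl

length-allFin : ∀ n → length (allFin n) ≡ n
length-allFin n = length-tabulate (λ x → x)

module _ {n} (p q : Fin n → Bool) where

  count-mono : (∀ x → p x ≡ true → q x ≡ true) → count p ≤ count q
  count-mono p⇒q = ∑-mono-≤ (allFin n) (λ x → indicator-mono (p⇒q x))

  count-∨ : count (λ x → p x ∨ q x) ≤ count p + count q
  count-∨ = ≤-trans (∑-mono-≤ (allFin n) (λ x → indicator-∨ (p x) (q x)))
                    (≤-reflexive (∑-distrib-+ (allFin n) _ _))

  count-split : count p ≤ count (λ x → p x ∧ not (q x)) + count q
  count-split = ≤-trans (∑-mono-≤ (allFin n) (λ x → indicator-split (p x) (q x)))
                        (≤-reflexive (∑-distrib-+ (allFin n) _ _))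

count-suc : (p : Fin (suc n) → Bool) → count p ≡ indicator (p zero) + count (λ x → p (suc x))
count-suc p = cong (λ L → indicator (p zero) + sum L)
  (trans (map-tabulate suc (λ x → indicator (p x))) (sym (map-tabulate (λ x → x) (λ x → indicator (p (suc x))))))

count>0⇒∃ : (p : Fin n → Bool) → 0 < count p → ∃[ x ] p x ≡ true
count>0⇒∃ {n} p 0<count
  with x , _ ← ∑-<⇒∃-< (allFin n) (λ _ → 0) (λ x → indicator (p x))
                 (subst (_< count p) (sym (∑-zero (allFin n))) 0<count)
  with p x in px
... | true = x , px

count-≟ : (y : Fin n) → count (λ x → does (x ≟ y)) ≤ 1
count-≟ {suc n} zero    = ≤-reflexive (trans (count-suc (λ (x : Fin (suc n)) → does (x ≟ zero)))
                                             (cong suc (∑-zero (allFin n))))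
count-≟ {suc n} (suc y) = ≤-trans (≤-reflexive (count-suc (λ (x : Fin (suc n)) → does (x ≟ suc y)))) (count-≟ y)

_∈ᵇ_ : Fin n → List (Fin n) → Bool
x ∈ᵇ F = does (any? (x ≟_) F)

count-∈ᵇ : (F : List (Fin n)) → count (_∈ᵇ F) ≤ length F
count-∈ᵇ {n} []      = ≤-reflexive (∑-zero (allFin n))
count-∈ᵇ     (y ∷ F) = ≤-trans (count-∨ (λ x → does (x ≟ y)) (_∈ᵇ F)) (+-mono-≤ (count-≟ y) (count-∈ᵇ F))

count-avoiding : (p : Fin n → Bool) (F : List (Fin n)) → count p ≤ count (λ x → p x ∧ not (x ∈ᵇ F)) + length F
count-avoiding p F = ≤-trans (count-split p (_∈ᵇ F)) (+-monoʳ-≤ _ (count-∈ᵇ F))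

length<count⇒∃∉ : (p : Fin n → Bool) (F : List (Fin n)) → length F < count p → ∃[ x ] p x ≡ true × x ∉ F
length<count⇒∃∉ p F |F|<|p|
  with x , _ ← count>0⇒∃ (λ x → p x ∧ not (x ∈ᵇ F))
                 (+-cancelʳ-< (length F) 0 _ (<-≤-trans |F|<|p| (count-avoiding p F)))
  with p x in px | any? (x ≟_) F
... | true | no x∉F = x , px , x∉F

distinctRepresentatives : ∀ m (P : Fin m → Fin n → Bool) (F : List (Fin n)) → (∀ i → m + length F ≤ count (P i)) →
  Σ (Fin m → Fin n) λ g → Injective _≡_ _≡_ g × (∀ i → P i (g i) ≡ true) × (∀ i → g i ∉ F)
distinctRepresentatives zero    P F large = (λ ()) , (λ {}) , (λ ()) , (λ ())
distinctRepresentatives (suc m) P F large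
  with x , Px , x∉F ← length<count⇒∃∉ (P zero) F (≤-trans (s≤s (m≤n+m (length F) m)) (large zero))
  with g , g-injective , Pg , g∉x∷F ← distinctRepresentatives m (λ i → P (suc i)) (x ∷ F)
                                         (λ i → ≤-trans (≤-reflexive (+-suc m (length F))) (large (suc i)))
  = g′ , g′-injective , (λ { zero → Px ; (suc i) → Pg i }) , (λ { zero → x∉F ; (suc i) → g∉x∷F i ∘ there })
  where
  g′ : Fin (suc m) → Fin _
  g′ zero    = x
  g′ (suc i) = g i
  g′-injective : Injective _≡_ _≡_ g′
  g′-injective {zero}  {zero}  _     = refl
  g′-injective {zero}  {suc j} x≡gj  = contradiction (here (sym x≡gj)) (g∉x∷F j)
  g′-injective {suc i} {zero}  gi≡x  = contradiction (here gi≡x) (g∉x∷F i)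
  g′-injective {suc i} {suc j} gi≡gj = cong suc (g-injective gi≡gj)

all : (A → Bool) → Vec A d → Bool
all p []       = true
all p (x ∷ xs) = p x ∧ all p xs

all-true : (xs : Vec A d) → all (λ _ → true) xs ≡ true
all-true []       = refl
all-true (x ∷ xs) = all-true xs

all-∧ : (p q : A → Bool) (xs : Vec A d) → all (λ x → p x ∧ q x) xs ≡ all p xs ∧ all q xs
all-∧ p q []       = refl
all-∧ p q (x ∷ xs) rewrite all-∧ p q xs = ∧-interchange (p x) (q x) (all p xs) (all q xs)

all-comm : (R : A → B → Bool) (xs : Vec A d) (ys : Vec B e) →
           all (λ x → all (R x) ys) xs ≡ all (λ y → all (λ x → R x y) xs) ys
all-comm R []       ys = sym (all-true ys)
all-comm R (x ∷ xs) ys rewrite all-comm R xs ys = sym (all-∧ (R x) (λ y → all (λ x′ → R x′ y) xs) ys)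

all-mono : {p q : A → Bool} → (∀ x → p x ≡ true → q x ≡ true) →
           (xs : Vec A d) → all p xs ≡ true → all q xs ≡ true
all-mono p⇒q []       _     = refl
all-mono p⇒q (x ∷ xs) all-p with px , all-p′ ← ∧-true⁻ all-p rewrite p⇒q x px = all-mono p⇒q xs all-p′

padTo : ∀ d → A → List A → Vec A d
padTo zero    x L       = []
padTo (suc d) x []      = x ∷ padTo d x []
padTo (suc d) x (y ∷ L) = y ∷ padTo d x L

all-padTo : (p : A → Bool) {x : A} {L : List A} → p x ≡ true → (∀ {y} → y ∈ L → p y ≡ true) →
            all p (padTo d x L) ≡ true
all-padTo {d = zero}  p             px pL = refl
all-padTo {d = suc d} p {L = []}    px pL rewrite px = all-padTo {d = d} p px pL
all-padTo {d = suc d} p {L = y ∷ L} px pL rewrite pL (here refl) = all-padTo {d = d} p px (pL ∘ there)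

all-padTo⁻ : (p : A → Bool) {x : A} {L : List A} → length L ≤ d → all p (padTo d x L) ≡ true →
             ∀ {y} → y ∈ L → p y ≡ true
all-padTo⁻ {d = suc d} p {L = y ∷ L} _           all-p (here refl) = proj₁ (∧-true⁻ all-p)
all-padTo⁻ {d = suc d} p {L = y ∷ L} (s≤s |L|≤d) all-p (there y∈L) =
  all-padTo⁻ p |L|≤d (proj₂ (∧-true⁻ all-p)) y∈L

tuples : ∀ n d → List (Vec (Fin n) d)
tuples n zero    = [ [] ]
tuples n (suc d) = concatMap (λ v → map (v ∷_) (tuples n d)) (allFin n)

∑-tuples-suc : (f : Vec (Fin n) (suc d) → ℕ) →
               ∑ (tuples n (suc d)) f ≡ ∑[ v ∈ allFin n ] ∑[ T ∈ tuples n d ] f (v ∷ T)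
∑-tuples-suc {n} {d} f = trans (∑-concatMap _ (allFin n) f) (∑-cong (allFin n) (λ v → ∑-map (v ∷_) (tuples n d) f))

∑-tuples-const : ∀ n d (c : ℕ) → ∑[ _ ∈ tuples n d ] c ≡ n ^ d * c
∑-tuples-const n zero    c = refl
∑-tuples-const n (suc d) c = begin
  ∑[ _ ∈ tuples n (suc d) ] c              ≡⟨ ∑-tuples-suc {n = n} {d = d} (λ _ → c) ⟩
  ∑[ _ ∈ allFin n ] ∑[ _ ∈ tuples n d ] c  ≡⟨ ∑-cong (allFin n) (λ _ → ∑-tuples-const n d c) ⟩
  ∑[ _ ∈ allFin n ] (n ^ d * c)            ≡⟨ ∑-const (allFin n) _ ⟩
  length (allFin n) * (n ^ d * c)          ≡⟨ cong (_* (n ^ d * c)) (length-allFin n) ⟩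
  n * (n ^ d * c)                          ≡⟨ *-assoc n (n ^ d) c ⟨
  n ^ suc d * c                            ∎
  where open ≡-Reasoning

≤∑-tuples : (f : Vec (Fin n) d → ℕ) (T : Vec (Fin n) d) → f T ≤ ∑ (tuples n d) f
≤∑-tuples f []      = m≤m+n (f []) 0
≤∑-tuples {n} {suc d} f (v ∷ T) = begin
  f (v ∷ T)
    ≤⟨ ≤∑-tuples (λ T′ → f (v ∷ T′)) T ⟩
  ∑[ T′ ∈ tuples n d ] f (v ∷ T′)
    ≤⟨ ∈⇒≤∑ (λ v′ → ∑[ T′ ∈ tuples n d ] f (v′ ∷ T′)) (∈-allFin v) ⟩
  ∑[ v′ ∈ allFin n ] ∑[ T′ ∈ tuples n d ] f (v′ ∷ T′)
    ≡⟨ ∑-tuples-suc f ⟨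
  ∑ (tuples n (suc d)) f ∎
  where open ≤-Reasoning

∑-tuples-all : (p : Fin n → Bool) (d : ℕ) → ∑[ T ∈ tuples n d ] indicator (all p T) ≡ count p ^ d
∑-tuples-all         p zero    = refl
∑-tuples-all {n = n} p (suc d) = begin
  ∑[ T ∈ tuples n (suc d) ] indicator (all p T)
    ≡⟨ ∑-tuples-suc {n = n} {d = d} (λ T → indicator (all p T)) ⟩
  ∑[ v ∈ allFin n ] ∑[ T ∈ tuples n d ] indicator (p v ∧ all p T)
    ≡⟨ ∑-cong (allFin n) (λ v → trans (∑-cong (tuples n d) (λ T → indicator-∧ (p v) (all p T)))
                                      (*-distribˡ-∑ (tuples n d) (indicator (p v)) (λ T → indicator (all p T)))) ⟩
  ∑[ v ∈ allFin n ] (indicator (p v) * ∑[ T ∈ tuples n d ] indicator (all p T))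
    ≡⟨ *-distribʳ-∑ (allFin n) _ _ ⟩
  count p * ∑[ T ∈ tuples n d ] indicator (all p T)
    ≡⟨ cong (count p *_) (∑-tuples-all p d) ⟩
  count p ^ suc d ∎
  where open ≡-Reasoning

-- Dependent random choice

commonOutNbr : (Fin n → Fin n → Bool) → Vec (Fin n) d → Fin n → Bool
commonOutNbr R S t = all (λ s → R s t) S

commonInNbr : (Fin n → Fin n → Bool) → Vec (Fin n) d → Fin n → Bool
commonInNbr R T u = all (R u) T

fewCommonOutNbrs : (Fin n → Fin n → Bool) → ℕ → Vec (Fin n) d → Bool
fewCommonOutNbrs R K S = count (commonOutNbr R S) <ᵇ K

badCount : (Fin n → Fin n → Bool) → ℕ → Vec (Fin n) d → ℕ
badCount {n} {d} R K T = ∑[ S ∈ tuples n d ] indicator (all (commonInNbr R T) S ∧ fewCommonOutNbrs R K S)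

∑-count-commonInNbr : (R : Fin n → Fin n → Bool) (d : ℕ) →
  ∑[ T ∈ tuples n d ] count (commonInNbr R T) ≡ ∑[ u ∈ allFin n ] (count (R u) ^ d)
∑-count-commonInNbr {n} R d =
  trans (∑-comm (tuples n d) (allFin n) _) (∑-cong (allFin n) (λ u → ∑-tuples-all (R u) d))

pow-indicator-< : ∀ c K d → c ^ d * indicator (c <ᵇ K) ≤ K ^ d
pow-indicator-< c K d with c <ᵇ K in c<ᵇK
... | true  = ≤-trans (≤-reflexive (*-identityʳ (c ^ d))) (^-monoˡ-≤ d (<⇒≤ (<ᵇ-true⁻ c<ᵇK)))
... | false = subst (_≤ K ^ d) (sym (*-zeroʳ (c ^ d))) z≤n

-- Counted from the side of S instead: each S with c common out-neighbours lies in exactly c^d of the U(T).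
∑-badCount : (R : Fin n → Fin n → Bool) (d K : ℕ) → ∑ (tuples n d) (badCount R K) ≤ n ^ d * K ^ d
∑-badCount {n} R d K = begin
  ∑[ T ∈ tuples n d ] ∑[ S ∈ tuples n d ] indicator (all (commonInNbr R T) S ∧ few S)
    ≡⟨ ∑-comm (tuples n d) (tuples n d) _ ⟩
  ∑[ S ∈ tuples n d ] ∑[ T ∈ tuples n d ] indicator (all (commonInNbr R T) S ∧ few S)
    ≡⟨ ∑-cong (tuples n d) (λ S → ∑-cong (tuples n d) (λ T →
         trans (cong (λ b → indicator (b ∧ few S)) (all-comm R S T)) (indicator-∧ (all (commonOutNbr R S) T) (few S)))) ⟩
  ∑[ S ∈ tuples n d ] ∑[ T ∈ tuples n d ] (indicator (all (commonOutNbr R S) T) * indicator (few S))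
    ≡⟨ ∑-cong (tuples n d) (λ S → trans (*-distribʳ-∑ (tuples n d) (indicator (few S)) _)
                                        (cong (_* indicator (few S)) (∑-tuples-all (commonOutNbr R S) d))) ⟩
  ∑[ S ∈ tuples n d ] (count (commonOutNbr R S) ^ d * indicator (few S))
    ≤⟨ ∑-mono-≤ (tuples n d) (λ S → pow-indicator-< (count (commonOutNbr R S)) K d) ⟩
  ∑[ _ ∈ tuples n d ] (K ^ d)
    ≡⟨ ∑-tuples-const n d (K ^ d) ⟩
  n ^ d * K ^ d ∎
  where
  open ≤-Reasoning
  few = fewCommonOutNbrs R K

∃-tuple-fewBad : (R : Fin n → Fin n → Bool) (d h K : ℕ) →
  (h + K ^ suc d) * n ^ (d + suc d) < (∑[ u ∈ allFin n ] count (R u)) ^ suc d →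
  ∃[ T ] h + badCount R K T < count (commonInNbr {d = suc d} R T)
∃-tuple-fewBad {n} R d h K dense =
  ∑-<⇒∃-< (tuples n D) (λ T → h + badCount R K T) (λ T → count (commonInNbr R T)) (*-cancelˡ-< (n ^ d) _ _ (begin-strict
    n ^ d * ∑[ T ∈ tuples n D ] (h + badCount R K T)     ≤⟨ *-monoʳ-≤ (n ^ d) ∑-h+badCount ⟩
    n ^ d * (n ^ D * (h + K ^ D))                        ≡⟨ *-assoc (n ^ d) (n ^ D) _ ⟨
    n ^ d * n ^ D * (h + K ^ D)                          ≡⟨ cong (_* (h + K ^ D)) (^-distribˡ-+-* n d D) ⟨
    n ^ (d + D) * (h + K ^ D)                            ≡⟨ *-comm (n ^ (d + D)) (h + K ^ D) ⟩
    (h + K ^ D) * n ^ (d + D)                            <⟨ dense ⟩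
    (∑[ u ∈ allFin n ] count (R u)) ^ D                  ≤⟨ powerMean (allFin n) (λ u → count (R u)) d ⟩
    length (allFin n) ^ d * ∑[ u ∈ allFin n ] (count (R u) ^ D)
                          ≡⟨ cong (λ ℓ → ℓ ^ d * ∑[ u ∈ allFin n ] (count (R u) ^ D)) (length-allFin n) ⟩
    n ^ d * ∑[ u ∈ allFin n ] (count (R u) ^ D)          ≡⟨ cong (n ^ d *_) (∑-count-commonInNbr R D) ⟨
    n ^ d * ∑[ T ∈ tuples n D ] count (commonInNbr R T)  ∎))
  where
  open ≤-Reasoning
  D = suc d
  ∑-h+badCount : ∑[ T ∈ tuples n D ] (h + badCount R K T) ≤ n ^ D * (h + K ^ D)
  ∑-h+badCount = begin
    ∑[ T ∈ tuples n D ] (h + badCount R K T)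
      ≡⟨ ∑-distrib-+ (tuples n D) (λ _ → h) (badCount R K) ⟩
    ∑[ _ ∈ tuples n D ] h + ∑ (tuples n D) (badCount R K)
      ≤⟨ +-mono-≤ (≤-reflexive (∑-tuples-const n D h)) (∑-badCount R D K) ⟩
    n ^ D * h + n ^ D * K ^ D
      ≡⟨ *-distribˡ-+ (n ^ D) h (K ^ D) ⟨
    n ^ D * (h + K ^ D) ∎

removeBadTuples : (U : Fin n → Bool) (bad : Vec (Fin n) (suc d) → Bool) (h : ℕ) →
  h + ∑[ S ∈ tuples n (suc d) ] indicator (all U S ∧ bad S) ≤ count U →
  ∃[ U′ ] h ≤ count U′ × (∀ S → all U′ S ≡ true → bad S ≡ false)
removeBadTuples {n} {d} U bad h large = U′ , h≤|U′| , U′-good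
  where
  badFrom : Fin n → ℕ
  badFrom u = ∑[ S ∈ tuples n d ] indicator (all U (u ∷ S) ∧ bad (u ∷ S))
  removed : Fin n → Bool
  removed u = 0 <ᵇ badFrom u
  U′ : Fin n → Bool
  U′ u = U u ∧ not (removed u)
  removed≤badFrom : ∀ u → indicator (removed u) ≤ badFrom u
  removed≤badFrom u with removed u in 0<ᵇb
  ... | true  = <ᵇ-true⁻ 0<ᵇb
  ... | false = z≤n
  h≤|U′| : h ≤ count U′
  h≤|U′| = +-cancelʳ-≤ _ h (count U′) (begin
    h + ∑[ S ∈ tuples n (suc d) ] indicator (all U S ∧ bad S)
      ≤⟨ large ⟩
    count U
      ≤⟨ count-split U removed ⟩
    count U′ + count removed
      ≤⟨ +-monoʳ-≤ (count U′) (∑-mono-≤ (allFin n) removed≤badFrom) ⟩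
    count U′ + ∑ (allFin n) badFrom
      ≡⟨ cong (count U′ +_) (∑-tuples-suc (λ S → indicator (all U S ∧ bad S))) ⟨
    count U′ + ∑[ S ∈ tuples n (suc d) ] indicator (all U S ∧ bad S) ∎)
    where open ≤-Reasoning
  removed⇒∉U′ : ∀ u → 0 < badFrom u → U u ∧ not (removed u) ≢ true
  removed⇒∉U′ u 0<b with removed u in removed-u
  ... | true  = λ U∧false → contradiction (proj₂ (∧-true⁻ {U u} U∧false)) λ ()
  ... | false = contradiction (<ᵇ-false⁻ removed-u) (<⇒≱ 0<b)
  U′-good : ∀ S → all U′ S ≡ true → bad S ≡ false
  U′-good (u ∷ S) all-U′ with bad (u ∷ S) in bad-uS
  ... | false = refl
  ... | true  = contradiction (proj₁ (∧-true⁻ all-U′)) (removed⇒∉U′ u (subst (_≤ badFrom u) uS-counted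
                  (≤∑-tuples (λ S′ → indicator (all U (u ∷ S′) ∧ bad (u ∷ S′))) S)))
    where
    uS-counted : indicator (all U (u ∷ S) ∧ bad (u ∷ S)) ≡ 1
    uS-counted = cong₂ (λ a b → indicator (a ∧ b)) (all-mono (λ x → proj₁ ∘ ∧-true⁻) (u ∷ S) all-U′) bad-uS

dependentRandomChoice : (R : Fin n → Fin n → Bool) (d h K : ℕ) →
  (h + K ^ suc d) * n ^ (d + suc d) < (∑[ u ∈ allFin n ] count (R u)) ^ suc d →
  ∃[ U ] h ≤ count U × (∀ (S : Vec (Fin n) (suc d)) → all U S ≡ true → K ≤ count (commonOutNbr R S))
dependentRandomChoice R d h K dense
  with T , fewBad ← ∃-tuple-fewBad R d h K dense
  with U , h≤|U| , U-good ← removeBadTuples (commonInNbr R T) (fewCommonOutNbrs R K) h (<⇒≤ fewBad)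
  = U , h≤|U| , λ S all-U → <ᵇ-false⁻ (U-good S all-U)

-- Embedding H

length-filterᵇ : (p : A → Bool) (L : List A) → length (filterᵇ p L) ≡ ∑[ x ∈ L ] indicator (p x)
length-filterᵇ p []      = refl
length-filterᵇ p (x ∷ L) with p x
... | true  = cong suc (length-filterᵇ p L)
... | false = length-filterᵇ p L

inDegree : OrientedGraph h → Fin h → ℕ
inDegree H v = count (λ u → arc H u v)

outDegree : OrientedGraph h → Fin h → ℕ
outDegree H v = count (arc H v)

inNbrs : OrientedGraph h → Fin h → List (Fin h)
inNbrs {h} H v = filterᵇ (λ u → arc H u v) (allFin h)

∈-inNbrs : (H : OrientedGraph h) {u v : Fin h} → arc H u v ≡ true → u ∈ inNbrs H v
∈-inNbrs H {u} uv = ∈-filter⁺ (λ w → T? (arc H w _)) (∈-allFin u) (subst T (sym uv) tt)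

embedding : (H : OrientedGraph h) (side : Fin h → Bool) → WellOriented H side →
  (∀ v → side v ≡ false → inDegree H v ≤ suc d) →
  (G : OrientedGraph n) (U : Fin n → Bool) → h ≤ count U →
  (∀ (S : Vec (Fin n) (suc d)) → all U S ≡ true → h + h ≤ count (commonOutNbr (arc G) S)) →
  Contains G H
embedding {h} {d} {n} H side wellOriented inDegree≤ G U h≤|U| rich = φ , φ-injective , φ-arc
  where
  headReps = distinctRepresentatives h (λ _ → U) [] (λ _ → subst (_≤ count U) (sym (+-identityʳ h)) h≤|U|)
  ψ : Fin h → Fin n
  ψ = proj₁ headReps
  ψ∈U : ∀ v → U (ψ v) ≡ true
  ψ∈U = proj₁ (proj₂ (proj₂ headReps))
  ψ-image : List (Fin n)
  ψ-image = map ψ (allFin h)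
  -- Padding by ψ v costs nothing, since ψ v ∈ U; for an A-vertex v the tuple is unused.
  tails : Fin h → Vec (Fin n) (suc d)
  tails v = padTo (suc d) (ψ v) (map ψ (inNbrs H v))
  tails⊆U : ∀ v → all U (tails v) ≡ true
  tails⊆U v = all-padTo {d = suc d} U {L = map ψ (inNbrs H v)} (ψ∈U v) λ y∈ψ[L] →
    let (x , _ , y≡ψx) = ∈-map⁻ ψ y∈ψ[L] in subst (λ y → U y ≡ true) (sym y≡ψx) (ψ∈U x)
  length-tails : ∀ v → side v ≡ false → length (map ψ (inNbrs H v)) ≤ suc d
  length-tails v sv = begin
    length (map ψ (inNbrs H v)) ≡⟨ length-map ψ (inNbrs H v) ⟩
    length (inNbrs H v)         ≡⟨ length-filterᵇ (λ w → arc H w v) (allFin h) ⟩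
    inDegree H v                ≤⟨ inDegree≤ v sv ⟩
    suc d                       ∎
    where open ≤-Reasoning
  length-ψ-image : length ψ-image ≡ h
  length-ψ-image = trans (length-map ψ (allFin h)) (length-allFin h)
  tailReps = distinctRepresentatives h (λ v → commonOutNbr (arc G) (tails v)) ψ-image λ v →
    subst (λ k → h + k ≤ count (commonOutNbr (arc G) (tails v))) (sym length-ψ-image) (rich (tails v) (tails⊆U v))
  χ : Fin h → Fin n
  χ = proj₁ tailReps
  ψ≢χ : ∀ u v → ψ u ≢ χ v
  ψ≢χ u v ψu≡χv = proj₂ (proj₂ (proj₂ tailReps)) v (subst (_∈ ψ-image) ψu≡χv (∈-map⁺ ψ (∈-allFin u)))
  φ : Fin h → Fin n
  φ v = if side v then ψ v else χ v
  φ-injective : Injective _≡_ _≡_ φ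
  φ-injective {u} {v} with side u | side v
  ... | true  | true  = proj₁ (proj₂ headReps)
  ... | false | false = proj₁ (proj₂ tailReps)
  ... | true  | false = λ ψu≡χv → contradiction ψu≡χv (ψ≢χ u v)
  ... | false | true  = λ χu≡ψv → contradiction (sym χu≡ψv) (ψ≢χ v u)
  φ-arc : ∀ u v → arc H u v ≡ true → arc G (φ u) (φ v) ≡ true
  φ-arc u v uv with su , sv ← wellOriented u v uv rewrite su | sv =
    all-padTo⁻ (λ s → arc G s (χ v)) (length-tails v sv) (proj₁ (proj₂ (proj₂ tailReps)) v)
               (∈-map⁺ ψ (∈-inNbrs H uv))

dense⇒Contains : (H : OrientedGraph h) (side : Fin h → Bool) → WellOriented H side →
  (∀ v → side v ≡ false → inDegree H v ≤ suc d) → (G : OrientedGraph n) →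
  (h + (h + h) ^ suc d) * n ^ (d + suc d) < (∑[ u ∈ allFin n ] count (arc G u)) ^ suc d → Contains G H
dense⇒Contains {h} {d} H side wellOriented inDegree≤ G dense =
  -- K = 2h common out-neighbours leave room to avoid the h images of A-vertices and the h earlier choices.
  let (U , h≤|U| , rich) = dependentRandomChoice (arc G) d h (h + h) dense
  in embedding H side wellOriented inDegree≤ G U h≤|U| rich

ArcBound : OrientedGraph h → ℕ → Set
ArcBound H D =
  ∃[ C ] ∃[ N ] (∀ (n : ℕ) → N ≤ n → (G : OrientedGraph n) → ¬ Contains G H → arcs G ^ D ≤ C * n ^ (2 * D ∸ 1))

arcBound : (H : OrientedGraph h) (side : Fin h → Bool) → WellOriented H side → {D : ℕ} → 1 ≤ D →
  (∀ v → side v ≡ false → inDegree H v ≤ D) → ArcBound H D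
arcBound {h} H side wellOriented {suc d} (s≤s z≤n) inDegree≤ = C , 0 , bound
  where
  C = h + (h + h) ^ suc d
  dense : ∀ n (G : OrientedGraph n) → C * n ^ (2 * suc d ∸ 1) < arcs G ^ suc d →
          C * n ^ (d + suc d) < (∑[ u ∈ allFin n ] count (arc G u)) ^ suc d
  dense n G = subst (λ k → C * n ^ k < arcs G ^ suc d) (cong (d +_) (+-identityʳ (suc d)))
  bound : ∀ n → 0 ≤ n → (G : OrientedGraph n) → ¬ Contains G H → arcs G ^ suc d ≤ C * n ^ (2 * suc d ∸ 1)
  bound n _ G H⊈G with ≤-<-connex (arcs G ^ suc d) (C * n ^ (2 * suc d ∸ 1))
  ... | inj₁ sparse = sparse
  ... | inj₂ notSparse = contradiction (dense⇒Contains H side wellOriented inDegree≤ G (dense n G notSparse)) H⊈G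

-- Reversing all arcs

reverse : OrientedGraph n → OrientedGraph n
reverse G = record { arc = λ u v → arc G v u ; loopless = loopless G ; oriented = λ u v → oriented G v u }

arcs-reverse : (G : OrientedGraph n) → arcs (reverse G) ≡ arcs G
arcs-reverse {n} G = ∑-comm (allFin n) (allFin n) (λ u v → indicator (arc G v u))

reverse-Contains : (G : OrientedGraph n) (H : OrientedGraph h) → Contains (reverse G) (reverse H) → Contains G H
reverse-Contains G H (φ , φ-injective , φ-arc) = φ , φ-injective , λ u v uv → φ-arc v u uv

reverse-WellOriented : (H : OrientedGraph h) (side : Fin h → Bool) →
                       WellOriented H side → WellOriented (reverse H) (not ∘ side)
reverse-WellOriented H side wellOriented u v vu with sv , su ← wellOriented v u vu = cong not su , cong not sv

reverse-ArcBound : {H : OrientedGraph h} {D : ℕ} → ArcBound (reverse H) D → ArcBound H D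
reverse-ArcBound {H = H} {D} (C , N , bound) = C , N , λ n N≤n G H⊈G →
  subst (λ m → m ^ D ≤ C * n ^ (2 * D ∸ 1)) (arcs-reverse G) (bound n N≤n (reverse G) (H⊈G ∘ reverse-Contains G H))

inDegree≤deg : (H : OrientedGraph h) (v : Fin h) → inDegree H v ≤ deg H v
inDegree≤deg H v = count-mono _ _ λ u uv → subst (λ b → arc H v u ∨ b ≡ true) (sym uv) (∨-zeroʳ (arc H v u))

outDegree≤deg : (H : OrientedGraph h) (v : Fin h) → outDegree H v ≤ deg H v
outDegree≤deg H v = count-mono _ _ λ u vu → subst (λ b → b ∨ arc H u v ≡ true) (sym vu) refl

≤foldr-⊔ : {L : List ℕ} {x : ℕ} → x ∈ L → x ≤ foldr _⊔_ 0 L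
≤foldr-⊔ {y ∷ L} (here refl)  = m≤m⊔n y (foldr _⊔_ 0 L)
≤foldr-⊔ {y ∷ L} (there x∈L) = ≤-trans (≤foldr-⊔ x∈L) (m≤n⊔m y (foldr _⊔_ 0 L))

≤maxFin : (f : Fin h → ℕ) (v : Fin h) → f v ≤ maxFin f
≤maxFin f v = ≤foldr-⊔ (∈-map⁺ f (∈-allFin v))

maxDegA maxDegB : OrientedGraph h → (Fin h → Bool) → ℕ
maxDegA H side = maxFin (λ v → if side v then deg H v else 0)
maxDegB H side = maxFin (λ v → if side v then 0 else deg H v)

module _ (H : OrientedGraph h) {side : Fin h → Bool} where

  inDegree≤Δ′ : maxDegB H side ≤ maxDegA H side → ∀ v → side v ≡ false → inDegree H v ≤ Δ' H side
  inDegree≤Δ′ B≤A v sv = begin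
    inDegree H v    ≤⟨ inDegree≤deg H v ⟩
    deg H v         ≤⟨ subst (λ b → (if b then 0 else deg H v) ≤ maxDegB H side) sv (≤maxFin _ v) ⟩
    maxDegB H side  ≡⟨ m≥n⇒m⊓n≡n B≤A ⟨
    Δ' H side       ∎
    where open ≤-Reasoning

  outDegree≤Δ′ : maxDegA H side ≤ maxDegB H side → ∀ v → side v ≡ true → outDegree H v ≤ Δ' H side
  outDegree≤Δ′ A≤B v sv = begin
    outDegree H v   ≤⟨ outDegree≤deg H v ⟩
    deg H v         ≤⟨ subst (λ b → (if b then deg H v else 0) ≤ maxDegA H side) sv (≤maxFin _ v) ⟩
    maxDegA H side  ≡⟨ m≤n⇒m⊓n≡m A≤B ⟨
    Δ' H side       ∎
    where open ≤-Reasoning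

corollary11 : ∀ (h : ℕ) (H : OrientedGraph h) (side : Fin h → Bool)
    → WellOriented H side
    → 1 ≤ Δ' H side
    → ∃[ C ] ∃[ N ] (∀ (n : ℕ) → N ≤ n → (G : OrientedGraph n) → ¬ Contains G H
    → arcs G ^ Δ' H side ≤ C * n ^ (2 * Δ' H side ∸ 1))
corollary11 h H side wellOriented 1≤Δ′ with ≤-total (maxDegB H side) (maxDegA H side)
... | inj₁ B≤A = arcBound H side wellOriented 1≤Δ′ (inDegree≤Δ′ H B≤A)
... | inj₂ A≤B = reverse-ArcBound {H = H} {D = Δ' H side}
                   (arcBound (reverse H) (not ∘ side) (reverse-WellOriented H side wellOriented) 1≤Δ′
                     λ v ¬sv → outDegree≤Δ′ H A≤B v (not-injective ¬sv))
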